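{- Let $G$ be a graph with nonnegative edge lengths, let $X\subseteq V(G)$, and let $T$ be a Steiner tree of $X$ in $G$ with cost $W$. For every $\epsilon>0$ there is a set $S\subseteq X$ of $O(1+1/\epsilon)$ vertices such that $X=\mathcal{G}_G(X,S,\epsilon W)$.
   Context: For a set $S$ of vertices, a set $X$ of vertices and a real $r\ge 0$, the group $\mathcal{G}_G(X,S,r)$ is the set consisting of $S$ together with all vertices of $X$ at distance (shortest-path distance in $G$ with respect to the edge lengths) at most $r$ from some vertex of $S$. A Steiner tree of $X$ is a tree subgraph of $G$ containing all vertices of $X$; its cost is the sum of its edge lengths.
   Formalization: The edge lengths of G are nonnegative rationals, and the parameter ε ranges over the positive rationals. -}

module Defs where

open import Data.Nat using (ℕ; suc)
open import Data.Fin using (Fin)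
open import Data.Fin.Subset using (Subset; _∈_; _⊆_; ∣_∣)
open import Data.Rational using (ℚ; 0ℚ; _+_; _≤_)
open import Data.Product using (_×_; _,_; proj₁; proj₂; Σ)
open import Data.Sum using (_⊎_)
open import Data.Bool using (if_then_else_)
open import Data.Vec.Functional using (foldr)
open import Data.Vec using (lookup)
open import Relation.Binary.PropositionalEquality using (_≡_)
open import Data.Bool using (true; false)

record Graph (n m : ℕ) : Set where
  field
    ends : Fin m → Fin n × Fin n
    len  : Fin m → ℚ

open Graph public

NonNegLengths : ∀ {n m} → Graph n m → Set
NonNegLengths G = ∀ e → 0ℚ ≤ len G e

Joins : ∀ {n m} → Graph n m → Fin m → Fin n → Fin n → Set
Joins G e u w = (ends G e ≡ (u , w)) ⊎ (ends G e ≡ (w , u))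

data Walk {n m} (G : Graph n m) (A : Subset m) : Fin n → Fin n → Set where
  stop : ∀ {u} → Walk G A u u
  step : ∀ {u w v} (e : Fin m) → e ∈ A → Joins G e u w → Walk G A w v → Walk G A u v

walkLen : ∀ {n m} {G : Graph n m} {A : Subset m} {u v} → Walk G A u v → ℚ
walkLen stop = 0ℚ
walkLen {G = G} (step e _ _ w) = len G e + walkLen w

allEdges : ∀ {m} → Subset m
allEdges {m} = Data.Vec.replicate m true
  where import Data.Vec

DistLe : ∀ {n m} → Graph n m → Fin n → Fin n → ℚ → Set
DistLe G u v r = Σ (Walk G allEdges u v) λ w → walkLen w ≤ r

cost : ∀ {n m} → Graph n m → Subset m → ℚ
cost {m = m} G A = foldr _+_ 0ℚ (λ e → if lookup A e then len G e else 0ℚ)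

-- (VT , ET) is a tree subgraph of G: ET's endpoints lie in VT, it is
-- connected, and |ET| + 1 = |VT| (connected with |E| = |V| - 1).
IsTreeSubgraph : ∀ {n m} → Graph n m → Subset n → Subset m → Set
IsTreeSubgraph {n} {m} G VT ET =
  (∀ e → e ∈ ET → (proj₁ (ends G e) ∈ VT) × (proj₂ (ends G e) ∈ VT))
  × (∀ u v → u ∈ VT → v ∈ VT → Walk G ET u v)
  × (suc ∣ ET ∣ ≡ ∣ VT ∣)

IsSteinerTree : ∀ {n m} → Graph n m → Subset n → Subset n → Subset m → Set
IsSteinerTree G X VT ET = IsTreeSubgraph G VT ET × (X ⊆ VT)

-- The group 𝒢_G(X,S,r): S together with all x ∈ X at distance ≤ r from some s ∈ S.
InGroup : ∀ {n m} → Graph n m → Subset n → Subset n → ℚ → Fin n → Set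
InGroup G X S r v = (v ∈ S) ⊎ ((v ∈ X) × Σ (Fin _) λ s → (s ∈ S) × DistLe G s v r)

-- Grow a closed walk through the Steiner tree by repeatedly taking an edge from a
-- visited vertex to an unvisited one and traversing it there and back: every edge
-- is paid for twice, so the walk visits all of X and has length at most 2W.
-- Walking along it, open a new centre at each vertex of X that is farther than
-- r = εW along the walk from the current centre. Consecutive centres are more
-- than r apart along the walk, so k·εW < 2W for k new centres, giving
-- |S| ≤ 1 + k ≤ 2(1 + 1/ε); and every vertex of X lies within r of its centre.
{-# OPTIONS --safe #-}
module Submission where

open import Defs
open import Data.Bool using (true; false; if_then_else_)
open import Data.Empty using (⊥-elim)
open import Data.Fin using (Fin; zero; suc; _≟_)
open import Data.Fin.Properties using (any?)
open import Data.Fin.Subset using (Subset; _⊆_; _∈_; _∉_; ∣_∣; ⊥; ⁅_⁆; inside)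
open import Data.Fin.Subset.Properties
  using (_∈?_; ∉⊥; ∈⊤; ⊥⊆; drop-∷-⊆; ∣⊥∣≡0; ∣p∣≤n; ∣p∣≤∣x∷p∣; ∣p∣≡n⇒p≡⊤;
         p⊂q⇒∣p∣<∣q∣; x∈⁅x⁆; x∈⁅y⁆⇒x≡y; ∣⁅x⁆∣≡1)
open import Data.Integer as ℤ using (+_)
import Data.Integer.Properties as ℤ
open import Data.Nat as ℕ using (ℕ; zero; suc; z≤n; s≤s)
import Data.Nat.Properties as ℕ
open import Data.Nat.Coprimality as Coprime using (1-coprimeTo)
open import Data.Product using (_×_; _,_; proj₁; proj₂; Σ; ∃)
open import Data.Product.Properties using (≡-dec)
open import Data.Rational using (ℚ; mkℚ; 0ℚ; 1ℚ; _+_; _*_; _≤_; _<_; _/_; 1/_; Positive; nonNegative)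
import Data.Rational.Properties as ℚ
open import Data.Rational.Properties using (pos⇒nonZero)
open import Data.Rational.Solver using (module +-*-Solver)
open import Data.Sum using (_⊎_; inj₁; inj₂; [_,_]; map₂)
open import Data.Vec using ([]; _∷_; here; there; _[_]≔_; lookup)
open import Data.Vec.Functional using (foldr)
open import Data.Vec.Properties using ([]≔-updates)
open import Function using (_∘_)
open import Relation.Binary.PropositionalEquality hiding ([_])
open import Relation.Nullary using (Dec; yes; no; ¬?; _×-dec_; _⊎-dec_)

open +-*-Solver using (solve; _:+_; _:*_; _:=_; con)

insert : ∀ {n} → Fin n → Subset n → Subset n
insert x p = p [ x ]≔ inside

x∈insert : ∀ {n} x (p : Subset n) → x ∈ insert x p
x∈insert x p = []≔-updates p x

∈-insert⁺ : ∀ {n} x (p : Subset n) {y} → y ∈ p → y ∈ insert x p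
∈-insert⁺ zero    (_ ∷ p) here        = here
∈-insert⁺ zero    (_ ∷ p) (there y∈p) = there y∈p
∈-insert⁺ (suc x) (_ ∷ p) here        = here
∈-insert⁺ (suc x) (_ ∷ p) (there y∈p) = there (∈-insert⁺ x p y∈p)

∈-insert⁻ : ∀ {n} x (p : Subset n) {y} → y ∈ insert x p → y ≡ x ⊎ y ∈ p
∈-insert⁻ zero    (_ ∷ p) here       = inj₁ refl
∈-insert⁻ zero    (_ ∷ p) (there y∈) = inj₂ (there y∈)
∈-insert⁻ (suc x) (_ ∷ p) here       = inj₂ here
∈-insert⁻ (suc x) (_ ∷ p) (there y∈) with ∈-insert⁻ x p y∈
... | inj₁ refl = inj₁ refl
... | inj₂ y∈p  = inj₂ (there y∈p)

∣insert∣≤ : ∀ {n} x (p : Subset n) → ∣ insert x p ∣ ℕ.≤ suc ∣ p ∣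
∣insert∣≤ zero    (b ∷ p)     = s≤s (∣p∣≤∣x∷p∣ b p)
∣insert∣≤ (suc x) (true ∷ p)  = s≤s (∣insert∣≤ x p)
∣insert∣≤ (suc x) (false ∷ p) = ∣insert∣≤ x p

∣p∣<∣insert∣ : ∀ {n x} (p : Subset n) → x ∉ p → ∣ p ∣ ℕ.< ∣ insert x p ∣
∣p∣<∣insert∣ {x = x} p x∉p = p⊂q⇒∣p∣<∣q∣ (∈-insert⁺ x p , x , x∈insert x p , x∉p)

sumOver : ∀ {m} → (Fin m → ℚ) → Subset m → ℚ
sumOver f p = foldr _+_ 0ℚ (λ i → if lookup p i then f i else 0ℚ)

sumOver-⊥ : ∀ {m} (f : Fin m → ℚ) → sumOver f ⊥ ≡ 0ℚ
sumOver-⊥ {zero}  f = refl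
sumOver-⊥ {suc m} f = trans (ℚ.+-identityˡ _) (sumOver-⊥ (f ∘ suc))

sumOver-insert : ∀ {m} (f : Fin m → ℚ) (p : Subset m) {x} → x ∉ p →
                 sumOver f (insert x p) ≡ sumOver f p + f x
sumOver-insert f (true ∷ p)  {zero}  x∉p = ⊥-elim (x∉p here)
sumOver-insert f (false ∷ p) {zero}  _   = begin
  f zero + rest          ≡⟨ ℚ.+-comm (f zero) rest ⟩
  rest + f zero          ≡⟨ cong (_+ f zero) (sym (ℚ.+-identityˡ rest)) ⟩
  (0ℚ + rest) + f zero   ∎
  where
  open ≡-Reasoning
  rest = sumOver (f ∘ suc) p
sumOver-insert f (b ∷ p)     {suc x} x∉p = begin
  first + sumOver (f ∘ suc) (insert x p)  ≡⟨ cong (_+_ first) (sumOver-insert (f ∘ suc) p (x∉p ∘ there)) ⟩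
  first + (sumOver (f ∘ suc) p + f (suc x)) ≡⟨ ℚ.+-assoc first _ _ ⟨
  (first + sumOver (f ∘ suc) p) + f (suc x) ∎
  where
  open ≡-Reasoning
  first = if b then f zero else 0ℚ

sumOver-mono : ∀ {m} {f : Fin m → ℚ} → (∀ i → 0ℚ ≤ f i) → ∀ {p q} → p ⊆ q → sumOver f p ≤ sumOver f q
sumOver-mono         f≥0 {[]}    {[]}    _   = ℚ.≤-refl
sumOver-mono {f = f} f≥0 {b ∷ p} {c ∷ q} p⊆q =
  ℚ.+-mono-≤ (first p⊆q) (sumOver-mono (f≥0 ∘ suc) (drop-∷-⊆ p⊆q))
  where
  first : ∀ {b c} → (zero ∈ b ∷ p → zero ∈ c ∷ q) → (if b then f zero else 0ℚ) ≤ (if c then f zero else 0ℚ)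
  first {true}  {true}  _ = ℚ.≤-refl
  first {true}  {false} sub with sub here
  ... | ()
  first {false} {true}  _ = f≥0 zero
  first {false} {false} _ = ℚ.≤-refl

cost-nonNeg : ∀ {n m} (G : Graph n m) → NonNegLengths G → ∀ A → 0ℚ ≤ cost G A
cost-nonNeg G nn A = subst (_≤ cost G A) (sumOver-⊥ (len G)) (sumOver-mono {f = len G} nn {⊥} {A} ⊥⊆)

fromℕ : ℕ → ℚ
fromℕ k = + k / 1

fromℕ-suc : ∀ k → fromℕ (suc k) ≡ 1ℚ + fromℕ k
fromℕ-suc k = sym (begin
  1ℚ + fromℕ k                        ≡⟨ cong (_+_ 1ℚ) (ℚ.↥p/↧p≡p k/1) ⟩
  (+ 1 ℤ.+ + k ℤ.* + 1) / 1           ≡⟨ ℚ./-cong (cong (ℤ._+_ (+ 1)) (ℤ.*-identityʳ (+ k))) refl ⟩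
  fromℕ (suc k)                       ∎)
  where
  open ≡-Reasoning
  k/1 = mkℚ (+ k) 0 (Coprime.sym (1-coprimeTo k))

fromℕ-mono : ∀ {j k} → j ℕ.≤ k → fromℕ j ≤ fromℕ k
fromℕ-mono {zero}  {zero}  z≤n     = ℚ.≤-refl
fromℕ-mono {zero}  {suc k} z≤n     = begin
  0ℚ            ≤⟨ fromℕ-mono {k = k} z≤n ⟩
  fromℕ k       ≡⟨ ℚ.+-identityˡ (fromℕ k) ⟨
  0ℚ + fromℕ k  ≤⟨ ℚ.+-monoˡ-≤ (fromℕ k) (ℚ.nonNegative⁻¹ 1ℚ) ⟩
  1ℚ + fromℕ k  ≡⟨ fromℕ-suc k ⟨
  fromℕ (suc k) ∎
  where open ℚ.≤-Reasoning
fromℕ-mono {suc j} {suc k} (s≤s j≤k) =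
  subst₂ _≤_ (sym (fromℕ-suc j)) (sym (fromℕ-suc k)) (ℚ.+-monoʳ-≤ 1ℚ (fromℕ-mono j≤k))

module _ {n m} (G : Graph n m) where

  joins-sym : ∀ {e u w} → Joins G e u w → Joins G e w u
  joins-sym (inj₁ eq) = inj₂ eq
  joins-sym (inj₂ eq) = inj₁ eq

  joins? : ∀ e u w → Dec (Joins G e u w)
  joins? e u w = ≡-dec _≟_ _≟_ (ends G e) (u , w) ⊎-dec ≡-dec _≟_ _≟_ (ends G e) (w , u)

  BothEnds : (Fin n → Set) → Fin m → Set
  BothEnds P e = P (proj₁ (ends G e)) × P (proj₂ (ends G e))

  bothEnds⁺ : ∀ {P : Fin n → Set} {e u w} → Joins G e u w → P u → P w → BothEnds P e
  bothEnds⁺ (inj₁ eq) pu pw rewrite eq = pu , pw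
  bothEnds⁺ (inj₂ eq) pu pw rewrite eq = pw , pu

  bothEnds⁻ : ∀ {P : Fin n → Set} {e u w} → Joins G e u w → BothEnds P e → P w
  bothEnds⁻ {P} (inj₁ eq) (_ , p₂) = subst P (cong proj₂ eq) p₂
  bothEnds⁻ {P} (inj₂ eq) (p₁ , _) = subst P (cong proj₁ eq) p₁

module Walks {n m} (G : Graph n m) where

  infixr 5 _++ʷ_
  _++ʷ_ : ∀ {A a b c} → Walk G A a b → Walk G A b c → Walk G A a c
  stop           ++ʷ q = q
  step e i j p   ++ʷ q = step e i j (p ++ʷ q)

  walkLen-++ʷ : ∀ {A a b c} (p : Walk G A a b) (q : Walk G A b c) →
                walkLen (p ++ʷ q) ≡ walkLen p + walkLen q
  walkLen-++ʷ stop         q = sym (ℚ.+-identityˡ (walkLen q))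
  walkLen-++ʷ (step e i j p) q =
    trans (cong (_+_ (len G e)) (walkLen-++ʷ p q)) (sym (ℚ.+-assoc (len G e) (walkLen p) (walkLen q)))

  walkLen-++ʷ-reassoc : ∀ {A a b c d} (p : Walk G A a b) (p′ : Walk G A b c) (q : Walk G A c d) →
                        walkLen (p ++ʷ p′) + walkLen q ≡ walkLen p + walkLen (p′ ++ʷ q)
  walkLen-++ʷ-reassoc p p′ q = begin
    walkLen (p ++ʷ p′) + walkLen q      ≡⟨ cong (_+ walkLen q) (walkLen-++ʷ p p′) ⟩
    (walkLen p + walkLen p′) + walkLen q ≡⟨ ℚ.+-assoc (walkLen p) (walkLen p′) (walkLen q) ⟩
    walkLen p + (walkLen p′ + walkLen q) ≡⟨ cong (_+_ (walkLen p)) (walkLen-++ʷ p′ q) ⟨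
    walkLen p + walkLen (p′ ++ʷ q)      ∎
    where open ≡-Reasoning

  walkLen-nonNeg : NonNegLengths G → ∀ {A a b} (p : Walk G A a b) → 0ℚ ≤ walkLen p
  walkLen-nonNeg nn stop           = ℚ.≤-refl
  walkLen-nonNeg nn (step e i j p) = ℚ.+-mono-≤ (nn e) (walkLen-nonNeg nn p)

  infix 4 _∈ʷ_
  _∈ʷ_ : ∀ {A a b} → Fin n → Walk G A a b → Set
  _∈ʷ_ {a = a} x stop           = x ≡ a
  _∈ʷ_ {a = a} x (step _ _ _ p) = x ≡ a ⊎ x ∈ʷ p

  start∈ʷ : ∀ {A a b} (p : Walk G A a b) → a ∈ʷ p
  start∈ʷ stop           = refl
  start∈ʷ (step _ _ _ _) = inj₁ refl

  ∈ʷ-++⁺ˡ : ∀ {A a b c x} (p : Walk G A a b) (q : Walk G A b c) → x ∈ʷ p → x ∈ʷ p ++ʷ q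
  ∈ʷ-++⁺ˡ stop           q refl       = start∈ʷ q
  ∈ʷ-++⁺ˡ (step _ _ _ p) q (inj₁ x≡a) = inj₁ x≡a
  ∈ʷ-++⁺ˡ (step _ _ _ p) q (inj₂ x∈p) = inj₂ (∈ʷ-++⁺ˡ p q x∈p)

  ∈ʷ-++⁺ʳ : ∀ {A a b c x} (p : Walk G A a b) (q : Walk G A b c) → x ∈ʷ q → x ∈ʷ p ++ʷ q
  ∈ʷ-++⁺ʳ stop           q x∈q = x∈q
  ∈ʷ-++⁺ʳ (step _ _ _ p) q x∈q = inj₂ (∈ʷ-++⁺ʳ p q x∈q)

  there-and-back : ∀ {A e u w} → e ∈ A → Joins G e u w → Walk G A u u
  there-and-back e∈A j = step _ e∈A j (step _ e∈A (joins-sym G j) stop)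

  splice : ∀ {A a b u} (p : Walk G A a b) → u ∈ʷ p → Walk G A u u → Walk G A a b
  splice stop           refl       d = d
  splice (step e i j p) (inj₁ refl) d = d ++ʷ step e i j p
  splice (step e i j p) (inj₂ u∈p)  d = step e i j (splice p u∈p d)

  walkLen-splice : ∀ {A a b u} (p : Walk G A a b) (u∈p : u ∈ʷ p) (d : Walk G A u u) →
                   walkLen (splice p u∈p d) ≡ walkLen p + walkLen d
  walkLen-splice stop           refl        d = sym (ℚ.+-identityˡ (walkLen d))
  walkLen-splice (step e i j p) (inj₁ refl) d =
    trans (walkLen-++ʷ d (step e i j p)) (ℚ.+-comm (walkLen d) _)
  walkLen-splice (step e i j p) (inj₂ u∈p)  d =
    trans (cong (_+_ (len G e)) (walkLen-splice p u∈p d)) (sym (ℚ.+-assoc (len G e) (walkLen p) (walkLen d)))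

  ∈ʷ-splice⁺ : ∀ {A a b u x} (p : Walk G A a b) (u∈p : u ∈ʷ p) (d : Walk G A u u) →
               x ∈ʷ p → x ∈ʷ splice p u∈p d
  ∈ʷ-splice⁺ stop           refl        d refl       = start∈ʷ d
  ∈ʷ-splice⁺ (step e i j p) (inj₁ refl) d x∈p        = ∈ʷ-++⁺ʳ d (step e i j p) x∈p
  ∈ʷ-splice⁺ (step e i j p) (inj₂ u∈p)  d (inj₁ x≡a) = inj₁ x≡a
  ∈ʷ-splice⁺ (step e i j p) (inj₂ u∈p)  d (inj₂ x∈p) = inj₂ (∈ʷ-splice⁺ p u∈p d x∈p)

  ∈ʷ-splice⁺-detour : ∀ {A a b u x} (p : Walk G A a b) (u∈p : u ∈ʷ p) (d : Walk G A u u) →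
                      x ∈ʷ d → x ∈ʷ splice p u∈p d
  ∈ʷ-splice⁺-detour stop           refl        d x∈d = x∈d
  ∈ʷ-splice⁺-detour (step e i j p) (inj₁ refl) d x∈d = ∈ʷ-++⁺ˡ d (step e i j p) x∈d
  ∈ʷ-splice⁺-detour (step e i j p) (inj₂ u∈p)  d x∈d = inj₂ (∈ʷ-splice⁺-detour p u∈p d x∈d)

module Tours {n m} (G : Graph n m) (nn : NonNegLengths G) (A : Subset m) (v0 : Fin n) where
  open Walks G

  record Tour (U : Subset n) : Set where
    field
      edges        : Subset m
      walk         : Walk G allEdges v0 v0
      visits       : ∀ {x} → x ∈ U → x ∈ʷ walk
      walkLen≤     : walkLen walk ≤ cost G edges + cost G edges
      edges⊆A      : edges ⊆ A
      edges-inside : ∀ {e} → e ∈ edges → BothEnds G (_∈ U) e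

  initial : Tour ⁅ v0 ⁆
  initial = record
    { edges        = ⊥
    ; walk         = stop
    ; visits       = x∈⁅y⁆⇒x≡y v0
    ; walkLen≤     = ℚ.≤-reflexive (sym (cong₂ _+_ (sumOver-⊥ (len G)) (sumOver-⊥ (len G))))
    ; edges⊆A      = ⊥⊆
    ; edges-inside = ⊥-elim ∘ ∉⊥
    }

  extend : ∀ {U e u w} → e ∈ A → u ∈ U → w ∉ U → Joins G e u w → Tour U → Tour (insert w U)
  extend {U} {e} {u} {w} e∈A u∈U w∉U j t = record
    { edges        = insert e edges
    ; walk         = splice walk (visits u∈U) detour
    ; visits       = visits′
    ; walkLen≤     = walkLen≤′
    ; edges⊆A      = [ (λ { refl → e∈A }) , edges⊆A ] ∘ ∈-insert⁻ e edges
    ; edges-inside = [ (λ { refl → bothEnds⁺ G j (∈-insert⁺ w U u∈U) (x∈insert w U) }) , inside′ ]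
                     ∘ ∈-insert⁻ e edges
    }
    where
    open Tour t
    detour = there-and-back ∈⊤ j

    e∉edges : e ∉ edges
    e∉edges = w∉U ∘ bothEnds⁻ G j ∘ edges-inside

    visits′ : ∀ {x} → x ∈ insert w U → x ∈ʷ splice walk (visits u∈U) detour
    visits′ x∈ with ∈-insert⁻ w U x∈
    ... | inj₁ refl = ∈ʷ-splice⁺-detour walk (visits u∈U) detour (inj₂ (inj₁ refl))
    ... | inj₂ x∈U  = ∈ʷ-splice⁺ walk (visits u∈U) detour (visits x∈U)

    inside′ : ∀ {e′} → e′ ∈ edges → BothEnds G (_∈ insert w U) e′
    inside′ e′∈ = let (p₁ , p₂) = edges-inside e′∈ in ∈-insert⁺ w U p₁ , ∈-insert⁺ w U p₂

    walkLen≤′ : walkLen (splice walk (visits u∈U) detour) ≤ cost G (insert e edges) + cost G (insert e edges)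
    walkLen≤′ = begin
      walkLen (splice walk (visits u∈U) detour) ≡⟨ walkLen-splice walk (visits u∈U) detour ⟩
      walkLen walk + (ℓ + (ℓ + 0ℚ))            ≤⟨ ℚ.+-monoˡ-≤ _ walkLen≤ ⟩
      (c + c) + (ℓ + (ℓ + 0ℚ))                 ≡⟨ solve 2 (λ c ℓ → (c :+ c) :+ (ℓ :+ (ℓ :+ con 0ℚ)) := (c :+ ℓ) :+ (c :+ ℓ)) refl c ℓ ⟩
      (c + ℓ) + (c + ℓ)                        ≡⟨ cong₂ _+_ cost′ cost′ ⟨
      cost G (insert e edges) + cost G (insert e edges) ∎
      where
      open ℚ.≤-Reasoning
      c = cost G edges
      ℓ = len G e
      cost′ : cost G (insert e edges) ≡ c + ℓ
      cost′ = sumOver-insert (len G) edges e∉edges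

  Crossing : Subset n → Set
  Crossing U = ∃ λ e → e ∈ A × ∃ λ u → ∃ λ w → (u ∈ U × w ∉ U) × Joins G e u w

  crossing? : ∀ U → Dec (Crossing U)
  crossing? U = any? λ e → e ∈? A ×-dec any? λ u → any? λ w →
                  (u ∈? U ×-dec ¬? (w ∈? U)) ×-dec joins? G e u w

  walk-crosses : ∀ {U a b} → a ∈ U → b ∉ U → Walk G A a b → Crossing U
  walk-crosses a∈U b∉U stop = ⊥-elim (b∉U a∈U)
  walk-crosses {U} a∈U b∉U (step {w = c} e e∈A j q) with c ∈? U
  ... | yes c∈U = walk-crosses c∈U b∉U q
  ... | no c∉U  = e , e∈A , _ , c , (a∈U , c∉U) , j

  grow : ∀ {V} → (∀ {x} → x ∈ V → Walk G A v0 x) →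
         ∀ k {U} → n ℕ.≤ k ℕ.+ ∣ U ∣ → v0 ∈ U → Tour U → ∃ λ U′ → V ⊆ U′ × Tour U′
  grow reach zero {U} full _ t =
    U , (λ _ → subst (_ ∈_) (sym (∣p∣≡n⇒p≡⊤ (ℕ.≤-antisym (∣p∣≤n U) full))) ∈⊤) , t
  grow {V} reach (suc k) {U} room v0∈U t with crossing? U
  ... | no none = U , covered , t
    where
    covered : V ⊆ U
    covered {x} x∈V with x ∈? U
    ... | yes x∈U = x∈U
    ... | no x∉U  = ⊥-elim (none (walk-crosses v0∈U x∉U (reach x∈V)))
  ... | yes (e , e∈A , u , w , (u∈U , w∉U) , j) =
    grow reach k room′ (∈-insert⁺ w U v0∈U) (extend e∈A u∈U w∉U j t)
    where
    room′ : n ℕ.≤ k ℕ.+ ∣ insert w U ∣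
    room′ = ℕ.≤-trans room (ℕ.≤-trans (ℕ.≤-reflexive (sym (ℕ.+-suc k ∣ U ∣)))
                                      (ℕ.+-monoʳ-≤ k (∣p∣<∣insert∣ U w∉U)))

  tour : ∀ {V} → (∀ {x} → x ∈ V → Walk G A v0 x) →
         ∃ λ (p : Walk G allEdges v0 v0) → (∀ {x} → x ∈ V → x ∈ʷ p) × walkLen p ≤ cost G A + cost G A
  tour reach with grow reach n (ℕ.m≤m+n n _) (x∈⁅x⁆ v0) initial
  ... | _ , V⊆U , t = walk , visits ∘ V⊆U , ℚ.≤-trans walkLen≤ (ℚ.+-mono-≤ cost≤ cost≤)
    where
    open Tour t
    cost≤ : cost G edges ≤ cost G A
    cost≤ = sumOver-mono nn edges⊆A

module Greedy {n m} (G : Graph n m) (nn : NonNegLengths G) (X : Subset n) (r : ℚ) (r≥0 : 0ℚ ≤ r) where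
  open Walks G

  Path : Fin n → Fin n → Set
  Path = Walk G allEdges

  -- p runs from the current centre s to the current position; q is what is left to walk.
  record Centres (s : Fin n) {a b} (p : Path s a) (q : Path a b) : Set where
    field
      centres    : Subset n
      cuts       : ℕ
      s∈centres  : s ∈ centres
      centres⊆X  : centres ⊆ X
      ∣centres∣≤ : ∣ centres ∣ ℕ.≤ suc cuts
      cuts-fit   : cuts ≡ 0 ⊎ fromℕ cuts * r < walkLen p + walkLen q
      covers     : ∀ {x} → x ∈ X → x ∈ʷ q → ∃ λ t → t ∈ centres × DistLe G t x r

  keepCentre : ∀ {s a c b e} {i : e ∈ allEdges} {j : Joins G e a c} {q : Path c b} (p : Path s a) →
         (a ∈ X → walkLen p ≤ r) → Centres s (p ++ʷ step e i j stop) q → Centres s p (step e i j q)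
  keepCentre {i = i} {j} {q} p near R = record
    { centres    = centres
    ; cuts       = cuts
    ; s∈centres  = s∈centres
    ; centres⊆X  = centres⊆X
    ; ∣centres∣≤ = ∣centres∣≤
    ; cuts-fit = map₂ (subst (fromℕ cuts * r <_) (walkLen-++ʷ-reassoc p (step _ i j stop) q)) cuts-fit
    ; covers   = λ { x∈X (inj₁ refl) → _ , s∈centres , p , near x∈X
                   ; x∈X (inj₂ x∈q)  → covers x∈X x∈q }
    }
    where open Centres R

  newCentre : ∀ {s a c b e} {i : e ∈ allEdges} {j : Joins G e a c} {q : Path c b} (p : Path s a) →
            s ∈ X → (a ∈ X → walkLen p ≤ r) → r < walkLen (p ++ʷ step e i j stop) →
            Centres c stop q → Centres s p (step e i j q)
  newCentre {s} {i = i} {j} {q} p s∈X near far R = record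
    { centres    = insert s centres
    ; cuts       = suc cuts
    ; s∈centres  = x∈insert s centres
    ; centres⊆X  = [ (λ { refl → s∈X }) , centres⊆X ] ∘ ∈-insert⁻ s centres
    ; ∣centres∣≤ = ℕ.≤-trans (∣insert∣≤ s centres) (s≤s ∣centres∣≤)
    ; cuts-fit   = inj₂ fit
    ; covers     = λ { x∈X (inj₁ refl) → s , x∈insert s centres , p , near x∈X
                     ; x∈X (inj₂ x∈q)  → let (t , t∈ , d) = covers x∈X x∈q in t , ∈-insert⁺ s centres t∈ , d }
    }
    where
    open Centres R

    cuts·r≤ : cuts ≡ 0 ⊎ fromℕ cuts * r < 0ℚ + walkLen q → fromℕ cuts * r ≤ walkLen q
    cuts·r≤ (inj₁ none) rewrite none = subst (_≤ walkLen q) (sym (ℚ.*-zeroˡ r)) (walkLen-nonNeg nn q)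
    cuts·r≤ (inj₂ lt)                = ℚ.<⇒≤ (subst (fromℕ cuts * r <_) (ℚ.+-identityˡ (walkLen q)) lt)

    fit : fromℕ (suc cuts) * r < walkLen p + walkLen (step _ i j q)
    fit = begin-strict
      fromℕ (suc cuts) * r                     ≡⟨ cong (_* r) (fromℕ-suc cuts) ⟩
      (1ℚ + fromℕ cuts) * r                    ≡⟨ solve 2 (λ k r → (con 1ℚ :+ k) :* r := r :+ k :* r) refl (fromℕ cuts) r ⟩
      r + fromℕ cuts * r                       <⟨ ℚ.+-mono-<-≤ far (cuts·r≤ cuts-fit) ⟩
      walkLen (p ++ʷ step _ i j stop) + walkLen q ≡⟨ walkLen-++ʷ-reassoc p (step _ i j stop) q ⟩
      walkLen p + walkLen (step _ i j q)       ∎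
      where open ℚ.≤-Reasoning hiding (stop)

  centresAlong : ∀ {s a b} → s ∈ X → (p : Path s a) → (a ∈ X → walkLen p ≤ r) → (q : Path a b) → Centres s p q
  centresAlong {s} s∈X p near stop = record
    { centres    = ⁅ s ⁆
    ; cuts       = 0
    ; s∈centres  = x∈⁅x⁆ s
    ; centres⊆X  = λ t∈ → subst (_∈ X) (sym (x∈⁅y⁆⇒x≡y s t∈)) s∈X
    ; ∣centres∣≤ = ℕ.≤-reflexive (∣⁅x⁆∣≡1 s)
    ; cuts-fit   = inj₁ refl
    ; covers     = λ { x∈X refl → s , x∈⁅x⁆ s , p , near x∈X }
    }
  centresAlong s∈X p near (step {w = c} e i j q) with c ∈? X
  ... | no c∉X = keepCentre p near (centresAlong s∈X (p ++ʷ step e i j stop) (⊥-elim ∘ c∉X) q)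
  ... | yes c∈X with walkLen (p ++ʷ step e i j stop) ℚ.≤? r
  ...   | yes close = keepCentre p near (centresAlong s∈X (p ++ʷ step e i j stop) (λ _ → close) q)
  ...   | no far    = newCentre p s∈X near (ℚ.≰⇒> far) (centresAlong c∈X stop (λ _ → r≥0) q)

Covers : ∀ {n m} → Graph n m → Subset n → Subset n → ℚ → Set
Covers G X S r = ∀ {x} → x ∈ X → ∃ λ t → t ∈ S × DistLe G t x r

steinerCentres : ∀ {n m} (G : Graph n m) → NonNegLengths G →
  (X VT : Subset n) (ET : Subset m) → IsSteinerTree G X VT ET → (r : ℚ) → 0ℚ ≤ r →
  ∃ λ S → S ⊆ X × Covers G X S r ×
    ∃ λ k → ∣ S ∣ ℕ.≤ suc k × (k ≡ 0 ⊎ fromℕ k * r < cost G ET + cost G ET)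
steinerCentres {n} G nn X VT ET ((_ , connected , _) , X⊆VT) r r≥0 with any? (_∈? X)
... | no X-empty =
  ⊥ , ⊥⊆ , (λ x∈X → ⊥-elim (X-empty (_ , x∈X))) , 0 , ℕ.≤-trans (ℕ.≤-reflexive (∣⊥∣≡0 n)) z≤n , inj₁ refl
... | yes (v0 , v0∈X) with Tours.tour G nn ET v0 (connected v0 _ (X⊆VT v0∈X))
...   | walk , visits , walkLen≤ =
  centres , centres⊆X , (λ x∈X → covers x∈X (visits (X⊆VT x∈X))) ,
  cuts , ∣centres∣≤ , map₂ (λ lt → ℚ.<-≤-trans (subst (fromℕ cuts * r <_) (ℚ.+-identityˡ _) lt) walkLen≤) cuts-fit
  where
  open Greedy G nn X r r≥0 using (centresAlong; module Centres)
  open Centres (centresAlong v0∈X stop (λ _ → r≥0) walk)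

inGroup⇔∈ : ∀ {n m} {G : Graph n m} {X S r} → S ⊆ X → Covers G X S r →
  ∀ v → (v ∈ X → InGroup G X S r v) × (InGroup G X S r v → v ∈ X)
inGroup⇔∈ S⊆X covered v = (λ v∈X → inj₂ (v∈X , covered v∈X)) , [ S⊆X , proj₁ ]

centres-bound : ∀ (ε : ℚ) .{{_ : Positive ε}} {W} → 0ℚ ≤ W → ∀ {s k} → s ℕ.≤ suc k →
  k ≡ 0 ⊎ fromℕ k * (ε * W) < W + W → fromℕ s ≤ fromℕ 2 * (1ℚ + (1/ ε) {{pos⇒nonZero ε}})
centres-bound ε {W} W≥0 {s} {k} s≤1+k fit = begin
  fromℕ s                          ≤⟨ fromℕ-mono s≤1+k ⟩
  fromℕ (suc k)                    ≡⟨ fromℕ-suc k ⟩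
  1ℚ + fromℕ k                     ≤⟨ ℚ.+-mono-≤ (fromℕ-mono {1} {2} (s≤s z≤n)) (cuts≤ fit) ⟩
  fromℕ 2 * 1ℚ + fromℕ 2 * (1/ ε)  ≡⟨ ℚ.*-distribˡ-+ (fromℕ 2) 1ℚ (1/ ε) ⟨
  fromℕ 2 * (1ℚ + 1/ ε)            ∎
  where
  open ℚ.≤-Reasoning
  instance
    ε≢0 = pos⇒nonZero ε
    1/ε>0 = ℚ.1/pos⇒pos ε
    1/ε≥0 = ℚ.pos⇒nonNeg (1/ ε)
    W≥0′ = nonNegative W≥0

  cuts≤ : k ≡ 0 ⊎ fromℕ k * (ε * W) < W + W → fromℕ k ≤ fromℕ 2 * (1/ ε)
  cuts≤ (inj₁ refl) = ℚ.nonNegative⁻¹ _ {{ℚ.nonNeg*nonNeg⇒nonNeg (fromℕ 2) (1/ ε)}}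
  cuts≤ (inj₂ lt)   = ℚ.<⇒≤ (begin-strict
    fromℕ k                 ≡⟨ kε/ε≡k ⟨
    (fromℕ k * ε) * (1/ ε)  <⟨ ℚ.*-monoˡ-<-pos (1/ ε) kε<2 ⟩
    fromℕ 2 * (1/ ε)        ∎)
    where
    kε/ε≡k : (fromℕ k * ε) * (1/ ε) ≡ fromℕ k
    kε/ε≡k = trans (ℚ.*-assoc (fromℕ k) ε (1/ ε)) (trans (cong (fromℕ k *_) (ℚ.*-inverseʳ ε)) (ℚ.*-identityʳ _))

    kε<2 : fromℕ k * ε < fromℕ 2
    kε<2 = ℚ.*-cancelʳ-<-nonNeg W (subst₂ _<_
      (solve 3 (λ k ε w → k :* (ε :* w) := (k :* ε) :* w) refl (fromℕ k) ε W)
      (solve 1 (λ w → w :+ w := con (fromℕ 2) :* w) refl W) lt)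

lemma11 : ∃ λ (c : ℕ) →
    ∀ {n m} (G : Graph n m) → NonNegLengths G →
    (X : Subset n) (VT : Subset n) (ET : Subset m) → IsSteinerTree G X VT ET →
    (ε : ℚ) .{{_ : Positive ε}} →
    Σ (Subset n) λ S → (S ⊆ X)
      × ((+ ∣ S ∣ / 1) ≤ (+ c / 1) * (1ℚ + (1/ ε) {{pos⇒nonZero ε}}))
      × (∀ v → (v ∈ X → InGroup G X S (ε * cost G ET) v)
             × (InGroup G X S (ε * cost G ET) v → v ∈ X))
lemma11 = 2 , λ G nn X VT ET steiner ε .{{ε>0}} →
  let W≥0 = cost-nonNeg G nn ET
      r≥0 = ℚ.nonNegative⁻¹ (ε * cost G ET) {{ℚ.nonNeg*nonNeg⇒nonNeg ε {{ℚ.pos⇒nonNeg ε}} (cost G ET) {{nonNegative W≥0}}}}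
      (S , S⊆X , covered , k , ∣S∣≤ , fit) = steinerCentres G nn X VT ET steiner (ε * cost G ET) r≥0
  in S , S⊆X , centres-bound ε W≥0 ∣S∣≤ fit , inGroup⇔∈ S⊆X covered
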